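{- If the triple $(a,b,c)$ of positive integers is good and $n=a+b+c$, then $b\leq\lfloor n/2\rfloor$.
   Context: For positive integers $a,b,c$ with $n=a+b+c$, the permutation of the triple $(a,b,c)$ is the permutation of $[n]$ with $p_i=n+1-i$ for $1\le i\le a$, $p_i=a+b+1-i$ for $a+1\le i\le a+b$, and $p_i=n+b+1-i$ for $a+b+1\le i\le n$ (one-line notation $n\cdots(n-a+1)\ b\cdots1\ (b+c)\cdots(b+1)$). The triple is good if this permutation, as a bijection $i\mapsto p_i$ of $[n]$, is a single $n$-cycle. -}

module Defs where

open import Data.Nat using (ℕ; zero; suc; _+_; _∸_; _≤_; _≤ᵇ_)
open import Data.Bool using (if_then_else_)
open import Data.Product using (∃-syntax)
open import Relation.Binary.PropositionalEquality using (_≡_)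

-- The permutation of the triple (a,b,c), n = a+b+c, as a function on ℕ
-- (only its values on [n] = {1,…,n} matter):
--   p i = n+1-i      for 1 ≤ i ≤ a
--   p i = a+b+1-i    for a+1 ≤ i ≤ a+b
--   p i = n+b+1-i    for a+b+1 ≤ i ≤ n
triplePerm : ℕ → ℕ → ℕ → ℕ → ℕ
triplePerm a b c i =
  if i ≤ᵇ a then suc n ∸ i
  else if i ≤ᵇ a + b then suc (a + b) ∸ i
  else suc (n + b) ∸ i
  where n = a + b + c

iter : (ℕ → ℕ) → ℕ → ℕ → ℕ
iter f zero    x = x
iter f (suc k) x = f (iter f k x)

-- A bijection f of [n] = {1,…,n} is a single n-cycle iff it has exactly
-- one orbit on [n]: every j ∈ [n] is reached from every i ∈ [n] by iterating f.
IsNCycle : ℕ → (ℕ → ℕ) → Set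
IsNCycle n f = ∀ i j → 1 ≤ i → i ≤ n → 1 ≤ j → j ≤ n → ∃[ k ] iter f k i ≡ j

Good : ℕ → ℕ → ℕ → Set
Good a b c = IsNCycle (a + b + c) (triplePerm a b c)

module Submission where

-- If a < b, the interval [a+1, b] lies inside the middle block
-- [a+1, a+b], on which the permutation acts as the reflection i ↦ a+b+1-i;
-- this reflection maps [a+1, b] into itself.  Hence the orbit of a+1 never
-- leaves [a+1, b], so it never reaches 1 ≤ a and the permutation is not a
-- single n-cycle.  A good triple therefore has b ≤ a, whence
-- 2b ≤ a + b ≤ n, i.e. b ≤ ⌊n/2⌋.

open import Defs
open import Data.Nat using (ℕ; _+_; _≤_; _/_)
open import Data.Nat using (suc; _∸_; _*_; _≤ᵇ_; _<_; s≤s; z≤n; zero)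
open import Data.Nat.Properties
open import Data.Nat.DivMod using (m*n/n≡m; /-monoˡ-≤)
open import Data.Bool using (true; false)
open import Data.Bool.Properties using (T-≡)
open import Data.Product using (_,_; _×_; ∃-syntax)
open import Function.Bundles using (Equivalence)
open import Relation.Nullary using (¬_; yes; no; contradiction)
open import Relation.Binary.PropositionalEquality using (_≡_; refl; cong; subst)

iter-preserves : (f : ℕ → ℕ) (P : ℕ → Set) → (∀ x → P x → P (f x)) →
                 ∀ k x → P x → P (iter f k x)
iter-preserves f P closed zero    x px = px
iter-preserves f P closed (suc k) x px =
  closed (iter f k x) (iter-preserves f P closed k x px)

≤ᵇ-true : ∀ {m n} → m ≤ n → (m ≤ᵇ n) ≡ true
≤ᵇ-true m≤n = Equivalence.to T-≡ (≤⇒≤ᵇ m≤n)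

≤ᵇ-false : ∀ {m n} → n < m → (m ≤ᵇ n) ≡ false
≤ᵇ-false {m} {n} n<m with m ≤ᵇ n in eq
... | false = refl
... | true  = contradiction (≤ᵇ⇒≤ m n (Equivalence.from T-≡ eq)) (<⇒≱ n<m)

triplePerm-middle : ∀ a b c x → a < x → x ≤ a + b →
                    triplePerm a b c x ≡ suc (a + b) ∸ x
triplePerm-middle a b c x a<x x≤a+b
  rewrite ≤ᵇ-false {x} {a} a<x | ≤ᵇ-true x≤a+b = refl

reflection-preserves : ∀ a b x → a < x → x ≤ b →
                       a < suc (a + b) ∸ x × suc (a + b) ∸ x ≤ b
reflection-preserves a b x a<x x≤b = lower , upper
  where
  open ≤-Reasoning
  lower : suc a ≤ suc (a + b) ∸ x
  lower = begin
    suc a             ≡⟨ m+n∸n≡m (suc a) b ⟨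
    suc a + b ∸ b     ≤⟨ ∸-monoʳ-≤ (suc a + b) x≤b ⟩
    suc (a + b) ∸ x   ∎
  upper : suc (a + b) ∸ x ≤ b
  upper = begin
    suc (a + b) ∸ x     ≤⟨ ∸-monoʳ-≤ (suc (a + b)) a<x ⟩
    suc (a + b) ∸ suc a ≡⟨ m+n∸m≡n (suc a) b ⟩
    b                   ∎

Between : ℕ → ℕ → ℕ → Set
Between a b x = a < x × x ≤ b

triplePerm-preserves : ∀ a b c x → Between a b x → Between a b (triplePerm a b c x)
triplePerm-preserves a b c x (a<x , x≤b)
  rewrite triplePerm-middle a b c x a<x (≤-trans x≤b (m≤n+m b a)) =
  reflection-preserves a b x a<x x≤b

-- If a < b, the orbit of a+1 stays in [a+1, b] and so never reaches 1 ≤ a.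
orbit-misses-1 : ∀ a b c → 1 ≤ a → a < b → ¬ (∃[ k ] iter (triplePerm a b c) k (suc a) ≡ 1)
orbit-misses-1 a b c 1≤a a<b (k , reaches1) = <⇒≱ a<1 1≤a
  where
  trapped : Between a b (iter (triplePerm a b c) k (suc a))
  trapped = iter-preserves (triplePerm a b c) (Between a b) (triplePerm-preserves a b c)
                           k (suc a) (≤-refl , a<b)
  a<1 : a < 1
  a<1 with subst (Between a b) reaches1 trapped
  ... | a<1 , _ = a<1

-- In a good triple with a ≥ 1 the middle block is no longer than the first,
-- since goodness demands that 1 be reached from a+1 ≤ b ≤ n.
good⇒b≤a : ∀ a b c → 1 ≤ a → Good a b c → b ≤ a
good⇒b≤a a b c 1≤a good with b ≤? a
... | yes b≤a = b≤a
... | no  b≰a = contradiction (good (suc a) 1 (s≤s z≤n) a+1≤n ≤-refl 1≤n)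
                              (orbit-misses-1 a b c 1≤a a<b)
  where
  a<b : a < b
  a<b = ≰⇒> b≰a
  a+1≤n : suc a ≤ a + b + c
  a+1≤n = ≤-trans a<b (≤-trans (m≤n+m b a) (m≤m+n (a + b) c))
  1≤n : 1 ≤ a + b + c
  1≤n = ≤-trans 1≤a (<⇒≤ a+1≤n)

≤a⇒≤half : ∀ a b c → b ≤ a → b ≤ (a + b + c) / 2
≤a⇒≤half a b c b≤a = begin
  b               ≡⟨ m*n/n≡m b 2 ⟨
  b * 2 / 2       ≤⟨ /-monoˡ-≤ 2 twice-b≤n ⟩
  (a + b + c) / 2 ∎
  where
  open ≤-Reasoning
  twice-b≤n : b * 2 ≤ a + b + c
  twice-b≤n = begin
    b * 2       ≡⟨ *-comm b 2 ⟩
    b + (b + 0) ≡⟨ cong (b +_) (+-identityʳ b) ⟩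
    b + b       ≤⟨ +-monoˡ-≤ b b≤a ⟩
    a + b       ≤⟨ m≤m+n (a + b) c ⟩
    a + b + c   ∎

corollary4 : ∀ a b c → 1 ≤ a → 1 ≤ b → 1 ≤ c → Good a b c → b ≤ (a + b + c) / 2
corollary4 a b c 1≤a _ _ good = ≤a⇒≤half a b c (good⇒b≤a a b c 1≤a good)
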